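{- Let $D$ be a finite simply-laced graph with no cycles all of whose vertices have degree $1$, $2$ or $3$. Then every move $T_i$ preserves the parity of the number of components of a labeling.
   Context: Reeder's puzzle on a finite simple graph: a labeling assigns $a_j\in\mathbb{Z}/2\mathbb{Z}$ to each vertex $j$; the move $T_i$ replaces $a_i$ by $a_i+\sum_k a_k \pmod 2$ (sum over the neighbors $k$ of $i$) and leaves all other labels unchanged. The components of a labeling are the connected components of the subgraph induced on vertices labeled $1$. -}

module Defs where

open import Data.Nat using (ℕ; zero; suc; _+_)
open import Data.Bool using (Bool; true; false; _∧_; _xor_; if_then_else_)
open import Data.Fin using (Fin; zero; suc; inject₁; fromℕ; _≟_)
open import Data.Vec.Functional using (foldr)
open import Data.Product using (Σ; _×_; ∃)
open import Relation.Binary.PropositionalEquality using (_≡_; _≢_)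
open import Relation.Binary.Construct.Closure.ReflexiveTransitive using (Star)
open import Function.Bundles using (_⇔_)
open import Function.Definitions using (Injective)
open import Relation.Nullary using (¬_)
open import Data.Sum using (_⊎_)

record SimpleGraph (n : ℕ) : Set where
  field
    adj   : Fin n → Fin n → Bool
    sym   : ∀ i j → adj i j ≡ adj j i
    irrefl : ∀ i → adj i i ≡ false
open SimpleGraph public

-- Labelings with values in ℤ/2ℤ, represented by Bool (true = 1, xor = +).
Labeling : ℕ → Set
Labeling n = Fin n → Bool

degree : ∀ {n} → SimpleGraph n → Fin n → ℕ
degree G i = foldr (λ b m → if b then suc m else m) 0 (adj G i)

record Cycle {n : ℕ} (G : SimpleGraph n) : Set where
  field
    len   : ℕ
    v     : Fin (suc (suc (suc len))) → Fin n
    inj   : Injective _≡_ _≡_ v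
    step  : ∀ (j : Fin (suc (suc len))) → adj G (v (inject₁ j)) (v (suc j)) ≡ true
    close : adj G (v (fromℕ (suc (suc len)))) (v zero) ≡ true

Acyclic : ∀ {n} → SimpleGraph n → Set
Acyclic G = ¬ Cycle G

nbrSum : ∀ {n} → SimpleGraph n → Labeling n → Fin n → Bool
nbrSum G a i = foldr _xor_ false (λ k → adj G i k ∧ a k)

move : ∀ {n} → SimpleGraph n → Fin n → Labeling n → Labeling n
move G i a j with j ≟ i
... | Relation.Nullary.yes _ = a i xor nbrSum G a i
... | Relation.Nullary.no  _ = a j

InducedEdge : ∀ {n} → SimpleGraph n → Labeling n → Fin n → Fin n → Set
InducedEdge G a x y = (adj G x y ≡ true) × (a x ≡ true) × (a y ≡ true)

Connected : ∀ {n} → SimpleGraph n → Labeling n → Fin n → Fin n → Set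
Connected G a = Star (InducedEdge G a)

-- "The labeling a has exactly k components": there is an assignment of each
-- vertex labelled 1 to one of k classes, surjective, with two labelled
-- vertices in the same class iff they are connected in the induced subgraph.
HasComponents : ∀ {n} → SimpleGraph n → Labeling n → ℕ → Set
HasComponents {n} G a k =
  Σ ((x : Fin n) → a x ≡ true → Fin k) λ c →
    (∀ x y (px : a x ≡ true) (py : a y ≡ true) → (c x px ≡ c y py) ⇔ Connected G a x y)
    × (∀ (j : Fin k) → ∃ λ x → Σ (a x ≡ true) λ px → c x px ≡ j)

-- If i has an even number of neighbours labelled 1, T_i changes nothing.
-- Otherwise T_i toggles a_i; let s be the labeling with i switched off and b
-- the one with i switched on. The components of b are those of s not adjacent
-- to i, together with the component of i, which absorbs every component of s
-- adjacent to i. In a forest no component of s contains two neighbours of i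
-- (they would close a cycle through i), so the number of absorbed components
-- is the number of labelled neighbours of i, which is odd. Parities are
-- computed as sums in (Bool, xor): the map sending each component of s to the
-- component of b containing it has fibres of odd size.

module Submission where

open import Defs hiding (sym)
open import Algebra.Bundles using (CommutativeRing)
open import Data.Bool using (Bool; true; false; _∧_; _xor_; if_then_else_)
open import Data.Bool.Properties using (xor-∧-commutativeRing; xor-identityʳ; not-involutive; ¬-not)
open import Data.Fin using (Fin; zero; suc; inject₁; fromℕ; punchIn) renaming (_≟_ to _≟ᶠ_)
open import Data.Fin.Properties using (punchInᵢ≢i)
open import Data.List using (List; []; _∷_; length; lookup)
open import Data.List.Membership.Propositional using (_∈_)
open import Data.List.Membership.Propositional.Properties using (∈-lookup)
open import Data.List.Relation.Unary.All as All using (All; []; _∷_)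
open import Data.List.Relation.Unary.All.Properties using (¬Any⇒All¬)
open import Data.List.Relation.Unary.Any using (here; there; any?)
open import Data.List.Relation.Unary.AllPairs using ([]; _∷_)
open import Data.List.Relation.Unary.Unique.Propositional using (Unique)
open import Data.Maybe using (Maybe; just; nothing; is-just)
open import Data.Nat using (ℕ; zero; suc; _%_)
open import Data.Product using (Σ; ∃-syntax; _×_; _,_; proj₁; proj₂)
open import Data.Sum using (_⊎_)
open import Function.Bundles using (Equivalence)
open import Function.Definitions using (Injective)
open import Level using (Level; _⊔_)
open import Relation.Binary.Core using (Rel)
open import Relation.Binary.Definitions using (DecidableEquality)
open import Relation.Binary.Construct.Closure.ReflexiveTransitive as Star using (Star; ε; _◅_; _◅◅_)
open import Relation.Binary.PropositionalEquality
open import Relation.Nullary using (¬_; does; yes; no; contradiction)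
open import Relation.Nullary.Decidable using (dec-true)

open CommutativeRing xor-∧-commutativeRing using (+-commutativeMonoid)
open import Algebra.Properties.CommutativeMonoid.Sum +-commutativeMonoid
  using (sum; sum-syntax; ∑-comm; sum-cong-≗; sum-remove; sum-replicate-zero)

-- Parity of finite sums in (Bool, xor)

parity : ℕ → Bool
parity k = ∑[ _ < k ] true

parity-%2 : ∀ k → k % 2 ≡ (if parity k then 1 else 0)
parity-%2 zero = refl
parity-%2 (suc zero) = refl
parity-%2 (suc (suc k)) rewrite not-involutive (parity k) = parity-%2 k

parity⇒%2 : ∀ k k′ → parity k ≡ parity k′ → k % 2 ≡ k′ % 2
parity⇒%2 k k′ eq = begin
  k % 2                          ≡⟨ parity-%2 k ⟩
  (if parity k then 1 else 0)    ≡⟨ cong (if_then 1 else 0) eq ⟩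
  (if parity k′ then 1 else 0)   ≡⟨ parity-%2 k′ ⟨
  k′ % 2                         ∎
  where open ≡-Reasoning

∑-false : ∀ {n} {f : Fin n → Bool} → (∀ x → f x ≡ false) → ∑[ x < n ] f x ≡ false
∑-false {n} f≡false = trans (sum-cong-≗ f≡false) (sum-replicate-zero n)

∑-unique : ∀ {n} {f : Fin n → Bool} (x₀ : Fin n) → f x₀ ≡ true →
           (∀ x → f x ≡ true → x ≡ x₀) → ∑[ x < n ] f x ≡ true
∑-unique {suc n} {f} x₀ fx₀ unique = begin
  sum f                                  ≡⟨ sum-remove {i = x₀} f ⟩
  f x₀ xor ∑[ x < n ] f (punchIn x₀ x)   ≡⟨ cong₂ _xor_ fx₀ (∑-false elsewhere) ⟩
  true                                   ∎
  where
  open ≡-Reasoning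
  elsewhere : ∀ x → f (punchIn x₀ x) ≡ false
  elsewhere x with f (punchIn x₀ x) in fx
  ... | true  = contradiction (unique _ fx) (punchInᵢ≢i x₀ x)
  ... | false = refl

≟-sound : ∀ {k} {c t : Fin k} → does (c ≟ᶠ t) ≡ true → c ≡ t
≟-sound {c = c} {t} eq with c ≟ᶠ t
... | yes c≡t = c≡t

_≟ʲ_ : ∀ {k} → Maybe (Fin k) → Fin k → Bool
nothing ≟ʲ t = false
just c  ≟ʲ t = does (c ≟ᶠ t)

∑-≟ʲ : ∀ {k} (m : Maybe (Fin k)) → ∑[ t < k ] (m ≟ʲ t) ≡ is-just m
∑-≟ʲ {k} nothing  = ∑-false {k} λ _ → refl
∑-≟ʲ {k} (just c) = ∑-unique c (dec-true (c ≟ᶠ c) refl) λ t c≡t → sym (≟-sound c≡t)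

∑-is-just : ∀ {n k} (g : Fin n → Maybe (Fin k)) →
            ∑[ x < n ] is-just (g x) ≡ ∑[ t < k ] ∑[ x < n ] (g x ≟ʲ t)
∑-is-just {n} {k} g = begin
  ∑[ x < n ] is-just (g x)             ≡⟨ sum-cong-≗ (λ x → ∑-≟ʲ (g x)) ⟨
  ∑[ x < n ] ∑[ t < k ] (g x ≟ʲ t)     ≡⟨ ∑-comm (λ x t → g x ≟ʲ t) ⟩
  ∑[ t < k ] ∑[ x < n ] (g x ≟ʲ t)     ∎
  where open ≡-Reasoning

parity-odd-fibres : ∀ {k k′} (f : Fin k → Fin k′) →
                    (∀ t → ∑[ c < k ] does (f c ≟ᶠ t) ≡ true) → parity k ≡ parity k′
parity-odd-fibres f odd = trans (∑-is-just (λ c → just (f c))) (sum-cong-≗ odd)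

-- Walks and cycles

private
  variable
    a r : Level
    A : Set a

unique-lookup-injective : ∀ {vs : List A} → Unique vs → Injective _≡_ _≡_ (lookup vs)
unique-lookup-injective (_ ∷ _) {zero} {zero} _ = refl
unique-lookup-injective (x∉ ∷ _) {zero} {suc q} eq = contradiction eq (All.lookup x∉ (∈-lookup q))
unique-lookup-injective (x∉ ∷ _) {suc p} {zero} eq = contradiction (sym eq) (All.lookup x∉ (∈-lookup p))
unique-lookup-injective (_ ∷ u) {suc p} {suc q} eq = cong suc (unique-lookup-injective u eq)

data Walk {A : Set a} (R : Rel A r) : A → A → List A → Set (a ⊔ r) where
  stop : ∀ {x} → Walk R x x (x ∷ [])
  step : ∀ {x y z vs} → R x z → Walk R z y vs → Walk R x y (x ∷ vs)

module _ {R : Rel A r} where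

  walk-map : ∀ {S : Rel A r} → (∀ {x y} → R x y → S x y) →
             ∀ {x y vs} → Walk R x y vs → Walk S x y vs
  walk-map f stop = stop
  walk-map f (step e w) = step (f e) (walk-map f w)

  walk-all : ∀ {P : A → Set} → (∀ {x y} → R x y → P x) →
             ∀ {x y vs} → P y → Walk R x y vs → All P vs
  walk-all source py stop = py ∷ []
  walk-all source py (step e w) = source e ∷ walk-all source py w

  walk-suffix : ∀ {x y z vs} → Walk R z y vs → Unique vs → x ∈ vs →
                ∃[ us ] Walk R x y us × Unique us
  walk-suffix stop u (here refl) = _ , stop , u
  walk-suffix (step e w) u (here refl) = _ , step e w , u
  walk-suffix (step e w) (_ ∷ u) (there x∈) = walk-suffix w u x∈

  loop-erase : DecidableEquality A → ∀ {x y} → Star R x y → ∃[ vs ] Walk R x y vs × Unique vs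
  loop-erase _≟_ ε = _ , stop , [] ∷ []
  loop-erase _≟_ {x} (e ◅ p) with loop-erase _≟_ p
  ... | vs , w , u with any? (x ≟_) vs
  ...   | yes x∈ = walk-suffix w u x∈
  ...   | no x∉ = x ∷ vs , step e w , ¬Any⇒All¬ vs x∉ ∷ u

  walk-lookup-last : ∀ {p x y vs} → Walk R x y vs → lookup (p ∷ vs) (fromℕ (length vs)) ≡ y
  walk-lookup-last stop = refl
  walk-lookup-last (step _ w) = walk-lookup-last w

Adj : ∀ {n} → SimpleGraph n → Rel (Fin n) Level.zero
Adj G x y = adj G x y ≡ true

module _ {n : ℕ} (G : SimpleGraph n) where

  Adj-sym : ∀ {x y} → Adj G x y → Adj G y x
  Adj-sym {x} {y} e = trans (SimpleGraph.sym G y x) e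

  Connected-sym : ∀ {a x y} → Connected G a x y → Connected G a y x
  Connected-sym = Star.reverse λ (e , ax , ay) → Adj-sym e , ay , ax

  Connected-mono : ∀ {a b} → (∀ x → a x ≡ true → b x ≡ true) →
                   ∀ {x y} → Connected G a x y → Connected G b x y
  Connected-mono a⊆b = Star.map λ {x} {y} (e , ax , ay) → e , a⊆b x ax , a⊆b y ay

  walk-adj-lookup : ∀ {p x y vs} → Adj G p x → Walk (Adj G) x y vs → (j : Fin (length vs)) →
                    Adj G (lookup (p ∷ vs) (inject₁ j)) (lookup (p ∷ vs) (suc j))
  walk-adj-lookup px stop zero = px
  walk-adj-lookup px (step _ _) zero = px
  walk-adj-lookup _ (step e w) (suc j) = walk-adj-lookup e w j

  cycle-through : ∀ {i x y z rest} → Adj G i x → Adj G y i →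
                  Walk (Adj G) x y (x ∷ z ∷ rest) → Unique (i ∷ x ∷ z ∷ rest) → Cycle G
  cycle-through {i} {x} {y} {z} {rest} ix yi w u = record
    { len   = length rest
    ; v     = lookup (i ∷ x ∷ z ∷ rest)
    ; inj   = unique-lookup-injective u
    ; step  = walk-adj-lookup ix w
    ; close = subst (λ v → Adj G v i) (sym (walk-lookup-last {p = i} w)) yi
    }

  closed-walk⇒cycle : ∀ {i x y vs} → Adj G i x → Adj G y i → x ≢ y →
                      Walk (Adj G) x y vs → Unique (i ∷ vs) → Cycle G
  closed-walk⇒cycle _ _ x≢y stop _ = contradiction refl x≢y
  closed-walk⇒cycle ix yi _ w@(step _ stop) u = cycle-through ix yi w u
  closed-walk⇒cycle ix yi _ w@(step _ (step _ _)) u = cycle-through ix yi w u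

  acyclic-neighbours-connected⇒≡ : Acyclic G → ∀ {a i x y} → a i ≡ false →
                                  Adj G i x → Adj G i y → a y ≡ true → Connected G a x y → x ≡ y
  acyclic-neighbours-connected⇒≡ acyclic {a} {i} {x} {y} ai ix iy ay p with x ≟ᶠ y
  ... | yes x≡y = x≡y
  ... | no x≢y with loop-erase _≟ᶠ_ p
  ...   | vs , w , u =
    contradiction (closed-walk⇒cycle ix (Adj-sym iy) x≢y (walk-map (λ (e , _) → e) w) (i∉vs ∷ u)) acyclic
    where
    i∉vs : All (i ≢_) vs
    i∉vs = All.map (λ { av refl → contradiction (trans (sym av) ai) λ () })
                   (walk-all (λ (_ , ax , _) → ax) ay w)

-- Components of a labeling

module Components {n : ℕ} (G : SimpleGraph n) (a : Labeling n) {k : ℕ}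
                  (h : HasComponents G a k) where

  component : (x : Fin n) → a x ≡ true → Fin k
  component = proj₁ h

  component-≡⇒Connected : ∀ {x y} (ax : a x ≡ true) (ay : a y ≡ true) →
                          component x ax ≡ component y ay → Connected G a x y
  component-≡⇒Connected {x} {y} ax ay = Equivalence.to (proj₁ (proj₂ h) x y ax ay)

  Connected⇒component-≡ : ∀ {x y} (ax : a x ≡ true) (ay : a y ≡ true) →
                          Connected G a x y → component x ax ≡ component y ay
  Connected⇒component-≡ {x} {y} ax ay = Equivalence.from (proj₁ (proj₂ h) x y ax ay)

  component-irrelevant : ∀ {x} (p q : a x ≡ true) → component x p ≡ component x q
  component-irrelevant p q = Connected⇒component-≡ p q ε

  rep : Fin k → Fin n
  rep c = proj₁ (proj₂ (proj₂ h) c)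

  rep-labelled : ∀ c → a (rep c) ≡ true
  rep-labelled c = proj₁ (proj₂ (proj₂ (proj₂ h) c))

  component-rep : ∀ c → component (rep c) (rep-labelled c) ≡ c
  component-rep c = proj₂ (proj₂ (proj₂ (proj₂ h) c))

  -- The extra equation argument lets proofs generalise over the value of a x.
  component-at : ∀ x b → a x ≡ b → Maybe (Fin k)
  component-at x true  ax = just (component x ax)
  component-at x false _  = nothing

  componentᵐ : Fin n → Maybe (Fin k)
  componentᵐ x = component-at x (a x) refl

  is-just-componentᵐ : ∀ x → is-just (componentᵐ x) ≡ a x
  is-just-componentᵐ x = go (a x) refl
    where
    go : ∀ b (ax : a x ≡ b) → is-just (component-at x b ax) ≡ b
    go true  _ = refl
    go false _ = refl

  componentᵐ-sound : ∀ {x c} → componentᵐ x ≟ʲ c ≡ true → Σ (a x ≡ true) λ ax → component x ax ≡ c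
  componentᵐ-sound {x} = go (a x) refl
    where
    go : ∀ {c} b (ax : a x ≡ b) → component-at x b ax ≟ʲ c ≡ true → Σ (a x ≡ true) λ ax → component x ax ≡ c
    go true ax eq = ax , ≟-sound eq

  componentᵐ-complete : ∀ {x} (ax : a x ≡ true) → componentᵐ x ≟ʲ component x ax ≡ true
  componentᵐ-complete {x} ax = go (a x) refl ax
    where
    go : ∀ b (ax′ : a x ≡ b) (ax : a x ≡ true) → component-at x b ax′ ≟ʲ component x ax ≡ true
    go true  ax′ ax = dec-true (_ ≟ᶠ _) (component-irrelevant ax′ ax)
    go false ax′ ax = contradiction (trans (sym ax′) ax) λ ()

module Refinement {n : ℕ} {G : SimpleGraph n} {s b : Labeling n} {k k′ : ℕ}
                  (s⊆b : ∀ x → s x ≡ true → b x ≡ true)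
                  (hs : HasComponents G s k) (hb : HasComponents G b k′) where

  module S = Components G s hs
  module B = Components G b hb

  merge : Fin k → Fin k′
  merge c = B.component (S.rep c) (s⊆b _ (S.rep-labelled c))

  merge-component : ∀ {x} (sx : s x ≡ true) → merge (S.component x sx) ≡ B.component x (s⊆b x sx)
  merge-component sx = B.Connected⇒component-≡ _ _
    (Connected-mono G s⊆b (S.component-≡⇒Connected _ sx (S.component-rep _)))

  merge-Connected : ∀ {c x} (bx : b x ≡ true) → merge c ≡ B.component x bx →
                    Connected G b (S.rep c) x
  merge-Connected = B.component-≡⇒Connected _

  singleton-fibre : ∀ {x t} (sx : s x ≡ true) → B.component x (s⊆b x sx) ≡ t →
                    (∀ {y} → Connected G b y x → Connected G s y x) →
                    ∑[ c < k ] does (merge c ≟ᶠ t) ≡ true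
  singleton-fibre {x} sx refl closed =
    ∑-unique (S.component x sx) (dec-true (_ ≟ᶠ _) (merge-component sx)) λ c eq →
      trans (sym (S.component-rep c))
            (S.Connected⇒component-≡ _ sx (closed (merge-Connected (s⊆b _ sx) (≟-sound eq))))

parity-components-≗ : ∀ {n} {G : SimpleGraph n} {a b : Labeling n} {k k′} →
                      (∀ x → a x ≡ b x) → HasComponents G a k → HasComponents G b k′ →
                      parity k ≡ parity k′
parity-components-≗ {G = G} {a} {b} a≗b ha hb = parity-odd-fibres merge λ t →
  singleton-fibre (ax t) (trans (B.component-irrelevant _ _) (B.component-rep t))
                  (Connected-mono G b⊆a)
  where
  a⊆b : ∀ x → a x ≡ true → b x ≡ true
  a⊆b x ax = trans (sym (a≗b x)) ax
  b⊆a : ∀ x → b x ≡ true → a x ≡ true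
  b⊆a x bx = trans (a≗b x) bx
  open Refinement {G = G} a⊆b ha hb
  ax : ∀ t → a (B.rep t) ≡ true
  ax t = b⊆a _ (B.rep-labelled t)

module SwitchOn {n : ℕ} {G : SimpleGraph n} (acyclic : Acyclic G) {i : Fin n} {s b : Labeling n}
              (si : s i ≡ false) (bi : b i ≡ true) (agree : ∀ x → x ≢ i → s x ≡ b x) where

  s⊆b : ∀ x → s x ≡ true → b x ≡ true
  s⊆b x sx with x ≟ᶠ i
  ... | yes refl = contradiction (trans (sym sx) si) λ ()
  ... | no x≢i   = trans (sym (agree x x≢i)) sx

  avoid-i : ∀ {x y} → Connected G b x y → ¬ Connected G b x i → Connected G s x y
  avoid-i ε _ = ε
  avoid-i {x} (_◅_ {j = z} e@(xz , bx , bz) p) x≁i =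
    (xz , trans (agree x x≢i) bx , trans (agree z z≢i) bz) ◅ avoid-i p z≁i
    where
    z≁i : ¬ Connected G b z i
    z≁i z~i = x≁i (e ◅ z~i)
    x≢i : x ≢ i
    x≢i refl = x≁i ε
    z≢i : z ≢ i
    z≢i refl = z≁i ε

  reach-i : ∀ {x} → s x ≡ true → Connected G b x i →
            ∃[ j ] Adj G i j × Σ (s j ≡ true) λ _ → Connected G s x j
  reach-i sx ε = contradiction (trans (sym sx) si) λ ()
  reach-i {x} sx (_◅_ {j = z} (xz , _ , bz) p) with z ≟ᶠ i
  ... | yes refl = x , Adj-sym G xz , sx , ε
  ... | no z≢i   =
    let j , ij , sj , z~j = reach-i sz p in j , ij , sj , ((xz , sx , sz) ◅ z~j)
    where
    sz = trans (agree z z≢i) bz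

  attach-i : ∀ {x j} → Adj G i j → s j ≡ true → Connected G s x j → Connected G b x i
  attach-i {j = j} ij sj x~j = Connected-mono G s⊆b x~j ◅◅ ((Adj-sym G ij , s⊆b j sj , bi) ◅ ε)

  module _ {k k′} (hs : HasComponents G s k) (hb : HasComponents G b k′) where
    open Refinement {G = G} s⊆b hs hb

    neighbour-component : Fin n → Maybe (Fin k)
    neighbour-component x = if adj G i x then S.componentᵐ x else nothing

    is-just-neighbour-component : ∀ x → is-just (neighbour-component x) ≡ adj G i x ∧ s x
    is-just-neighbour-component x with adj G i x
    ... | true  = S.is-just-componentᵐ x
    ... | false = refl

    neighbour-component-sound : ∀ {x c} → neighbour-component x ≟ʲ c ≡ true →
                                Adj G i x × Σ (s x ≡ true) λ sx → S.component x sx ≡ c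
    neighbour-component-sound {x} eq with adj G i x
    ... | true = refl , S.componentᵐ-sound eq

    neighbour-component-complete : ∀ {x} → Adj G i x → (sx : s x ≡ true) →
                                   neighbour-component x ≟ʲ S.component x sx ≡ true
    neighbour-component-complete ix sx rewrite ix = S.componentᵐ-complete sx

    -- A component merged into that of i contains a neighbour of i by reach-i,
    -- and only one by acyclicity.
    merged-neighbours : ∀ c → does (merge c ≟ᶠ B.component i bi) ≡ ∑[ x < n ] (neighbour-component x ≟ʲ c)
    merged-neighbours c with merge c ≟ᶠ B.component i bi
    ... | no unmerged = sym (∑-false {n} λ x → ¬-not λ eq →
      let ix , sx , cx = neighbour-component-sound eq
      in unmerged (B.Connected⇒component-≡ _ bi
           (attach-i ix sx (S.component-≡⇒Connected _ sx (trans (S.component-rep c) (sym cx))))))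
    ... | yes merged with reach-i (S.rep-labelled c) (merge-Connected bi merged)
    ...   | j , ij , sj , c~j = sym (∑-unique j j-in-c unique)
      where
      cj : S.component j sj ≡ c
      cj = trans (sym (S.Connected⇒component-≡ _ sj c~j)) (S.component-rep c)
      j-in-c : neighbour-component j ≟ʲ c ≡ true
      j-in-c = subst (λ c′ → neighbour-component j ≟ʲ c′ ≡ true) cj (neighbour-component-complete ij sj)
      unique : ∀ x → neighbour-component x ≟ʲ c ≡ true → x ≡ j
      unique x eq =
        let ix , sx , cx = neighbour-component-sound eq
        in acyclic-neighbours-connected⇒≡ G acyclic si ix ij sj
             (S.component-≡⇒Connected sx sj (trans cx (sym cj)))

    fibre-i : ∑[ c < k ] does (merge c ≟ᶠ B.component i bi) ≡ nbrSum G s i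
    fibre-i = begin
      ∑[ c < k ] does (merge c ≟ᶠ B.component i bi)     ≡⟨ sum-cong-≗ merged-neighbours ⟩
      ∑[ c < k ] ∑[ x < n ] (neighbour-component x ≟ʲ c) ≡⟨ ∑-is-just neighbour-component ⟨
      ∑[ x < n ] is-just (neighbour-component x)         ≡⟨ sum-cong-≗ is-just-neighbour-component ⟩
      nbrSum G s i                                       ∎
      where open ≡-Reasoning

    fibre-other : ∀ t → t ≢ B.component i bi → ∑[ c < k ] does (merge c ≟ᶠ t) ≡ true
    fibre-other t t≢ti =
      singleton-fibre sx (trans (B.component-irrelevant _ _) (B.component-rep t))
        λ y~x → avoid-i y~x λ y~i → x≁i (Connected-sym G y~x ◅◅ y~i)
      where
      x = B.rep t
      x≁i : ¬ Connected G b x i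
      x≁i x~i = t≢ti (trans (sym (B.component-rep t)) (B.Connected⇒component-≡ _ bi x~i))
      x≢i : x ≢ i
      x≢i refl = x≁i ε
      sx : s x ≡ true
      sx = trans (agree x x≢i) (B.rep-labelled t)

    parity-components : nbrSum G s i ≡ true → parity k ≡ parity k′
    parity-components odd = parity-odd-fibres merge fibre
      where
      fibre : ∀ t → ∑[ c < k ] does (merge c ≟ᶠ t) ≡ true
      fibre t with t ≟ᶠ B.component i bi
      ... | yes refl = trans fibre-i odd
      ... | no t≢ti  = fibre-other t t≢ti

-- The move T_i

module _ {n : ℕ} (G : SimpleGraph n) (i : Fin n) (a : Labeling n) where

  move-≢ : ∀ {x} → x ≢ i → move G i a x ≡ a x
  move-≢ {x} x≢i with x ≟ᶠ i
  ... | yes x≡i = contradiction x≡i x≢i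
  ... | no _    = refl

  move-self : move G i a i ≡ a i xor nbrSum G a i
  move-self with i ≟ᶠ i
  ... | yes _  = refl
  ... | no i≢i = contradiction refl i≢i

  move-inert : nbrSum G a i ≡ false → ∀ x → a x ≡ move G i a x
  move-inert even x with x ≟ᶠ i
  ... | yes refl = sym (trans (cong (a x xor_) even) (xor-identityʳ (a x)))
  ... | no _     = refl

  nbrSum-move : nbrSum G (move G i a) i ≡ nbrSum G a i
  nbrSum-move = sum-cong-≗ pointwise
    where
    pointwise : ∀ x → adj G i x ∧ move G i a x ≡ adj G i x ∧ a x
    pointwise x with x ≟ᶠ i
    ... | yes refl rewrite irrefl G x = refl
    ... | no _     = refl

lemma1p18 : ∀ (n : ℕ) (G : SimpleGraph n) → Acyclic G →
    (∀ v → (degree G v ≡ 1) ⊎ ((degree G v ≡ 2) ⊎ (degree G v ≡ 3))) →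
    ∀ (i : Fin n) (a : Labeling n) (k k′ : ℕ) →
    HasComponents G a k → HasComponents G (move G i a) k′ →
    k % 2 ≡ k′ % 2
lemma1p18 n G acyclic _ i a k k′ ha hb = parity⇒%2 k k′ parity-move
  where
  parity-move : parity k ≡ parity k′
  parity-move with nbrSum G a i in ni | a i in ai
  ... | false | _ = parity-components-≗ {G = G} (move-inert G i a ni) ha hb
  ... | true | false =
    SwitchOn.parity-components acyclic ai (trans (move-self G i a) (cong₂ _xor_ ai ni))
      (λ _ x≢i → sym (move-≢ G i a x≢i)) ha hb ni
  ... | true | true = sym
    (SwitchOn.parity-components acyclic (trans (move-self G i a) (cong₂ _xor_ ai ni)) ai
      (λ _ x≢i → move-≢ G i a x≢i) hb ha (trans (nbrSum-move G i a) ni))
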